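{- Let \(\Pi\) be a derivation of a simple formula \(A\) in the system \(\mathrm{HA}+\mathrm{EM}_1\) described in the context. Assume that (1) \(\Pi\) has no principal branch with a head-cut or a non-normal term; (2) \(\Pi\) contains no free term variable; (3) \(\Pi\) has no open assumptions. Then \(\Pi\) is either atomic (only atomic formulas occur in it) or ends with an \(\exists\)-introduction rule instance. In particular, if \(\Pi\) is closed (no free term variables and no open assumptions), has no principal branch with a head-cut or a non-normal term, and \(A\) is simply existential, then \(\Pi\) ends with an introduction rule instance.
   Context: The system \(\mathrm{HA}+\mathrm{EM}_1\) is a natural deduction system for first-order Heyting arithmetic. Language: variables for natural numbers, a function symbol for every primitive recursive function (including \(0\) and successor \(S\)), the equality predicate, and the \(0\)-ary predicate \(\bot\) (never true); \(\neg A\) abbreviates \(A \to \bot\). Terms are reduced by the defining equations of the primitive recursive functions oriented left to right; a term is normal if no such reduction applies to it; closed normal terms are numerals \(S^n(0)\), and formulas are identified when they have the same normal form. Rules: the usual introduction and elimination rule for each of \(\land, \lor, \to, \forall, \exists\) (minimal logic, with discharge of assumptions); atomic rules, i.e. a recursive, sound set of rules whose premisses and conclusion are atomic, which do not discharge assumptions nor bind variables, containing the equality rules, ex falso \(\bot / P\) for atomic \(P\), \(S(x)=0/\bot\), \(S(x)=S(y)/x=y\), and, for every closed atomic \(P\), the axiom \(/P\) if \(P\) is true and the rule \(P/\bot\) if \(P\) is false; the induction rule Ind: from \(A[0/x]\) and a derivation of \(A[S(x)/x]\) from the discharged assumption \(A\), conclude \(A[t/x]\) (\(t\) is the main term); and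 the rule \(\mathrm{EM}_1\): for an atomic formula \(P\), from a derivation of \(C\) from the discharged assumption \(\forall x P\) (the universal assumption) and a derivation of \(C\) from the discharged assumption \(\neg P[y/x]\) (the existential assumption), where \(y\) does not occur in \(C\) nor in open assumptions other than \(\neg P[y/x]\), conclude \(C\). Ind and \(\mathrm{EM}_1\) are counted as neither introduction nor elimination rules. In an elimination rule the major premiss is the one containing the eliminated connective/quantifier, displayed leftmost; for \(\mathrm{EM}_1\) the leftmost premiss is the major one. Derivations are trees of formula occurrences. A rule instance binds a term variable as follows: \(\forall\)I binds its quantified variable in the derivation of its premiss; \(\exists\)E binds its eigenvariable in the derivation of its rightmost premiss; Ind binds \(x\) in the derivation of its rightmost premiss; \(\mathrm{EM}_1\) binds \(y\) in the derivation of its rightmost premiss. A term variable is free in a derivation if it occurs free in some formula occurrence and is not bound by any rule instance. A branch of a derivation \(\Pi\) is a sequence of formula occurrences \(\mathfrak{a}_0,\dotsc,\mathfrak{a}_n\) such that \(\mathfrak{a}_0\) is an assumption or the conclusion of an atomic axiom, \(\mathfrak{a}_i\) is a premiss and \(\mathfrak{a}_{i+1}\) the conclusion of one rule instance, and \(\mathfrak{a}_n\) is the conclusion of \(\Pi\). It is principal if whenever \(\mathfrak{a}_i\) is a premiss of an elimination or \(\mathrm{EM}_1\) rule instance, it is its major (leftmost) premiss. A principal branch has a non-normal term if some formula occurrence on it contains a non-normal term. The head-cut of a principal branch \(\mathfrak{a}_0,\dotsc,\mathfrak{a}_n\) is the \(\mathfrak{a}_i\) with maximal \(i\) such that one of the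 following holds (if such \(i\) exists, there is a head-cut along the branch): (a) \(\mathfrak{a}_i\) is the conclusion of an elimination rule instance whose major premiss \(\mathfrak{a}_{i-1}\) is the conclusion of an introduction rule instance, and when the latter is a \(\land\)I instance, \(\mathfrak{a}_{i-2}\) is an occurrence of the same formula as \(\mathfrak{a}_i\); (b) \(\mathfrak{a}_i\) is the conclusion of an Ind instance whose main term is \(0\) or \(S(s)\) for some term \(s\); (c) \(\mathfrak{a}_i\) is the conclusion of an \(\mathrm{EM}_1\) instance \(r\) and either \(\mathfrak{a}_{i-1}\) is derived without using the assumption discharged by \(r\), or \(\mathfrak{a}_0\) is an occurrence of the universal assumption discharged by \(r\) and \(\mathfrak{a}_1\) is an occurrence of a closed atomic formula; (d) \(\mathfrak{a}_i\) is the conclusion of an elimination rule instance and \(\mathfrak{a}_{i-1}\) is the conclusion of an \(\mathrm{EM}_1\) instance. A formula is simply existential if it is \(\exists x P\) with \(P\) atomic; it is simple if it is closed and either atomic or simply existential. -}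

module Defs where

open import Data.Nat using (ℕ; zero; suc)
open import Data.Fin using (Fin; zero; suc; toℕ)
open import Data.Vec using (Vec; []; _∷_; lookup) renaming (map to vmap)
open import Data.List using (List; []; _∷_; length) renaming (lookup to llookup; map to lmap)
open import Data.List.Relation.Unary.All using (All)
open import Data.List.Relation.Unary.Any using (Any)
open import Data.Maybe using (Maybe; just; nothing)
open import Data.Product using (Σ; ∃; _×_; _,_)
open import Data.Sum using (_⊎_)
open import Data.Empty using (⊥)
open import Relation.Nullary using (¬_; Dec)
open import Relation.Binary.PropositionalEquality using (_≡_; _≢_)
open import Relation.Binary.Construct.Closure.Equivalence using (EqClosure)
import Data.List.Relation.Binary.Pointwise
import Data.Nat

data PR : ℕ → Set where
  zeroF : PR 0
  succF : PR 1
  proj  : ∀ {n} → Fin n → PR n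
  comp  : ∀ {m n} → PR m → Vec (PR n) m → PR n
  rec   : ∀ {n} → PR n → PR (suc (suc n)) → PR (suc n)

mutual
  ⟦_⟧ : ∀ {n} → PR n → Vec ℕ n → ℕ
  ⟦ zeroF ⟧ xs = 0
  ⟦ succF ⟧ (x ∷ []) = suc x
  ⟦ proj i ⟧ xs = lookup xs i
  ⟦ comp g hs ⟧ xs = ⟦ g ⟧ (⟦ hs ⟧* xs)
  ⟦ rec g h ⟧ (k ∷ xs) = recℕ ⟦ g ⟧ ⟦ h ⟧ k xs

  ⟦_⟧* : ∀ {m n} → Vec (PR n) m → Vec ℕ n → Vec ℕ m
  ⟦ [] ⟧* xs = []
  ⟦ h ∷ hs ⟧* xs = ⟦ h ⟧ xs ∷ ⟦ hs ⟧* xs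

  recℕ : ∀ {n} → (Vec ℕ n → ℕ) → (Vec ℕ (suc (suc n)) → ℕ) → ℕ → Vec ℕ n → ℕ
  recℕ g h zero xs = g xs
  recℕ g h (suc k) xs = h (recℕ g h k xs ∷ k ∷ xs)

-- Terms and formulas, locally nameless / well-scoped:
-- free term variables are names (ℕ), bound variables are de Bruijn
-- indices in Fin n.

Name : Set
Name = ℕ

Label : Set
Label = ℕ

data Term (n : ℕ) : Set where
  fv  : Name → Term n
  bv  : Fin n → Term n
  app : ∀ {k} → PR k → Vec (Term n) k → Term n

𝟎 : ∀ {n} → Term n
𝟎 = app zeroF []

S : ∀ {n} → Term n → Term n
S t = app succF (t ∷ [])

infix 6 _≐_
infixr 5 _∧'_ _∨'_
infixr 4 _⇒_

data Formula (n : ℕ) : Set where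
  _≐_  : Term n → Term n → Formula n
  ⊥'   : Formula n
  _∧'_ : Formula n → Formula n → Formula n
  _∨'_ : Formula n → Formula n → Formula n
  _⇒_  : Formula n → Formula n → Formula n
  ∀'   : Formula (suc n) → Formula n
  ∃'   : Formula (suc n) → Formula n

¬' : ∀ {n} → Formula n → Formula n
¬' A = A ⇒ ⊥'

data Atomic {n : ℕ} : Formula n → Set where
  eqA  : ∀ t u → Atomic (t ≐ u)
  botA : Atomic ⊥'

mutual
  ren : ∀ {m k} → (Fin m → Fin k) → Term m → Term k
  ren ρ (fv x) = fv x
  ren ρ (bv i) = bv (ρ i)
  ren ρ (app f ts) = app f (ren* ρ ts)

  ren* : ∀ {m k j} → (Fin m → Fin k) → Vec (Term m) j → Vec (Term k) j
  ren* ρ [] = []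
  ren* ρ (t ∷ ts) = ren ρ t ∷ ren* ρ ts

wk : ∀ {n} → Term 0 → Term n
wk = ren (λ ())

mutual
  sub : ∀ {m k} → (Fin m → Term k) → Term m → Term k
  sub σ (fv x) = fv x
  sub σ (bv i) = σ i
  sub σ (app f ts) = app f (sub* σ ts)

  sub* : ∀ {m k j} → (Fin m → Term k) → Vec (Term m) j → Vec (Term k) j
  sub* σ [] = []
  sub* σ (t ∷ ts) = sub σ t ∷ sub* σ ts

liftS : ∀ {m k} → (Fin m → Term k) → Fin (suc m) → Term (suc k)
liftS σ zero = bv zero
liftS σ (suc i) = ren suc (σ i)

subF : ∀ {m k} → (Fin m → Term k) → Formula m → Formula k
subF σ (t ≐ u) = sub σ t ≐ sub σ u
subF σ ⊥' = ⊥'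
subF σ (A ∧' B) = subF σ A ∧' subF σ B
subF σ (A ∨' B) = subF σ A ∨' subF σ B
subF σ (A ⇒ B) = subF σ A ⇒ subF σ B
subF σ (∀' A) = ∀' (subF (liftS σ) A)
subF σ (∃' A) = ∃' (subF (liftS σ) A)

inst : Formula 1 → Term 0 → Formula 0
inst B t = subF (λ { zero → t }) B

mutual
  substT : ∀ {n} → Name → Term 0 → Term n → Term n
  substT x t (fv y) with x Data.Nat.≟ y
  ... | Relation.Nullary.yes _ = wk t
  ... | Relation.Nullary.no _ = fv y
  substT x t (bv i) = bv i
  substT x t (app f ts) = app f (substT* x t ts)

  substT* : ∀ {n j} → Name → Term 0 → Vec (Term n) j → Vec (Term n) j
  substT* x t [] = []
  substT* x t (s ∷ ss) = substT x t s ∷ substT* x t ss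

substF : ∀ {n} → Name → Term 0 → Formula n → Formula n
substF x t (a ≐ b) = substT x t a ≐ substT x t b
substF x t ⊥' = ⊥'
substF x t (A ∧' B) = substF x t A ∧' substF x t B
substF x t (A ∨' B) = substF x t A ∨' substF x t B
substF x t (A ⇒ B) = substF x t A ⇒ substF x t B
substF x t (∀' A) = ∀' (substF x t A)
substF x t (∃' A) = ∃' (substF x t A)

mutual
  data _∈fvT_ (x : Name) {n : ℕ} : Term n → Set where
    fvHere : x ∈fvT fv x
    fvApp  : ∀ {k} {f : PR k} {ts} → x ∈fvT* ts → x ∈fvT app f ts

  data _∈fvT*_ (x : Name) {n : ℕ} : ∀ {k} → Vec (Term n) k → Set where
    fvHd : ∀ {k t} {ts : Vec (Term n) k} → x ∈fvT t → x ∈fvT* (t ∷ ts)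
    fvTl : ∀ {k t} {ts : Vec (Term n) k} → x ∈fvT* ts → x ∈fvT* (t ∷ ts)

data _∈fv_ (x : Name) : ∀ {n} → Formula n → Set where
  fv≐ˡ : ∀ {n} {t u : Term n} → x ∈fvT t → x ∈fv (t ≐ u)
  fv≐ʳ : ∀ {n} {t u : Term n} → x ∈fvT u → x ∈fv (t ≐ u)
  fv∧ˡ : ∀ {n} {A B : Formula n} → x ∈fv A → x ∈fv (A ∧' B)
  fv∧ʳ : ∀ {n} {A B : Formula n} → x ∈fv B → x ∈fv (A ∧' B)
  fv∨ˡ : ∀ {n} {A B : Formula n} → x ∈fv A → x ∈fv (A ∨' B)
  fv∨ʳ : ∀ {n} {A B : Formula n} → x ∈fv B → x ∈fv (A ∨' B)
  fv⇒ˡ : ∀ {n} {A B : Formula n} → x ∈fv A → x ∈fv (A ⇒ B)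
  fv⇒ʳ : ∀ {n} {A B : Formula n} → x ∈fv B → x ∈fv (A ⇒ B)
  fv∀  : ∀ {n} {A : Formula (suc n)} → x ∈fv A → x ∈fv (∀' A)
  fv∃  : ∀ {n} {A : Formula (suc n)} → x ∈fv A → x ∈fv (∃' A)

-- a formula is closed: no free (term) variables (bound ones are
-- excluded by the scoping Formula 0)
Closed : Formula 0 → Set
Closed A = ∀ x → ¬ (x ∈fv A)

SimplyExistential : Formula 0 → Set
SimplyExistential A = Σ (Formula 1) λ P → Atomic P × A ≡ ∃' P

Simple : Formula 0 → Set
Simple A = Closed A × (Atomic A ⊎ SimplyExistential A)

mutual
  data _⟶_ {n : ℕ} : Term n → Term n → Set where
    β-proj : ∀ {k} (i : Fin k) (ts : Vec (Term n) k) →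
             app (proj i) ts ⟶ lookup ts i
    β-comp : ∀ {k m} (g : PR m) (hs : Vec (PR k) m) (ts : Vec (Term n) k) →
             app (comp g hs) ts ⟶ app g (vmap (λ h → app h ts) hs)
    β-rec0 : ∀ {k} (g : PR k) (h : PR (suc (suc k))) (ts : Vec (Term n) k) →
             app (rec g h) (𝟎 ∷ ts) ⟶ app g ts
    β-recS : ∀ {k} (g : PR k) (h : PR (suc (suc k))) (s : Term n) (ts : Vec (Term n) k) →
             app (rec g h) (S s ∷ ts) ⟶ app h (app (rec g h) (s ∷ ts) ∷ s ∷ ts)
    ξ-app  : ∀ {k} (f : PR k) {ts us : Vec (Term n) k} →
             ts ⟶* us → app f ts ⟶ app f us

  -- one argument reduces
  data _⟶*_ {n : ℕ} : ∀ {k} → Vec (Term n) k → Vec (Term n) k → Set where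
    hd : ∀ {k t t'} {ts : Vec (Term n) k} → t ⟶ t' → (t ∷ ts) ⟶* (t' ∷ ts)
    tl : ∀ {k t} {ts ts' : Vec (Term n) k} → ts ⟶* ts' → (t ∷ ts) ⟶* (t ∷ ts')

NormalT : ∀ {n} → Term n → Set
NormalT t = ∀ u → ¬ (t ⟶ u)

data NormalF : ∀ {n} → Formula n → Set where
  nf≐ : ∀ {n} {t u : Term n} → NormalT t → NormalT u → NormalF (t ≐ u)
  nf⊥ : ∀ {n} → NormalF {n} ⊥'
  nf∧ : ∀ {n} {A B : Formula n} → NormalF A → NormalF B → NormalF (A ∧' B)
  nf∨ : ∀ {n} {A B : Formula n} → NormalF A → NormalF B → NormalF (A ∨' B)
  nf⇒ : ∀ {n} {A B : Formula n} → NormalF A → NormalF B → NormalF (A ⇒ B)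
  nf∀ : ∀ {n} {A : Formula (suc n)} → NormalF A → NormalF (∀' A)
  nf∃ : ∀ {n} {A : Formula (suc n)} → NormalF A → NormalF (∃' A)

data _⟶F_ : ∀ {n} → Formula n → Formula n → Set where
  ≐ˡ : ∀ {n} {t t' u : Term n} → t ⟶ t' → (t ≐ u) ⟶F (t' ≐ u)
  ≐ʳ : ∀ {n} {t u u' : Term n} → u ⟶ u' → (t ≐ u) ⟶F (t ≐ u')
  ∧ˡ : ∀ {n} {A A' B : Formula n} → A ⟶F A' → (A ∧' B) ⟶F (A' ∧' B)
  ∧ʳ : ∀ {n} {A B B' : Formula n} → B ⟶F B' → (A ∧' B) ⟶F (A ∧' B')
  ∨ˡ : ∀ {n} {A A' B : Formula n} → A ⟶F A' → (A ∨' B) ⟶F (A' ∨' B)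
  ∨ʳ : ∀ {n} {A B B' : Formula n} → B ⟶F B' → (A ∨' B) ⟶F (A ∨' B')
  ⇒ˡ : ∀ {n} {A A' B : Formula n} → A ⟶F A' → (A ⇒ B) ⟶F (A' ⇒ B)
  ⇒ʳ : ∀ {n} {A B B' : Formula n} → B ⟶F B' → (A ⇒ B) ⟶F (A ⇒ B')
  ∀b : ∀ {n} {A A' : Formula (suc n)} → A ⟶F A' → ∀' A ⟶F ∀' A'
  ∃b : ∀ {n} {A A' : Formula (suc n)} → A ⟶F A' → ∃' A ⟶F ∃' A'

-- identification of formulas (same normal form = convertible, since
-- the term rewriting system is confluent and strongly normalising)
infix 3 _≈_
_≈_ : Formula 0 → Formula 0 → Set
_≈_ = EqClosure _⟶F_

mutual
  eval : (Name → ℕ) → Term 0 → ℕ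
  eval ρ (fv x) = ρ x
  eval ρ (bv ())
  eval ρ (app f ts) = ⟦ f ⟧ (eval* ρ ts)

  eval* : ∀ {k} → (Name → ℕ) → Vec (Term 0) k → Vec ℕ k
  eval* ρ [] = []
  eval* ρ (t ∷ ts) = eval ρ t ∷ eval* ρ ts

TrueAt : (Name → ℕ) → Formula 0 → Set
TrueAt ρ (t ≐ u) = eval ρ t ≡ eval ρ u
TrueAt ρ _ = ⊥

TrueClosed : Formula 0 → Set
TrueClosed = TrueAt (λ _ → 0)

record AtomicRules : Set₁ where
  field
    Rule       : List (Formula 0) → Formula 0 → Set
    recursive  : ∀ Ps Q → Dec (Rule Ps Q)
    atomicPrem : ∀ {Ps Q} → Rule Ps Q → All Atomic Ps
    atomicConc : ∀ {Ps Q} → Rule Ps Q → Atomic Q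
    sound      : ∀ {Ps Q} → Rule Ps Q → ∀ (ρ : Name → ℕ) →
                 All (TrueAt ρ) Ps → TrueAt ρ Q
    eq-refl    : ∀ (t : Term 0) → Rule [] (t ≐ t)
    eq-subst   : ∀ (x : Name) (t u : Term 0) (P : Formula 0) → Atomic P →
                 Rule ((t ≐ u) ∷ substF x t P ∷ []) (substF x u P)
    ex-falso   : ∀ (P : Formula 0) → Atomic P → Rule (⊥' ∷ []) P
    S≠0        : ∀ (t : Term 0) → Rule ((S t ≐ 𝟎) ∷ []) ⊥'
    S-inj      : ∀ (t u : Term 0) → Rule ((S t ≐ S u) ∷ []) (t ≐ u)
    true-ax    : ∀ (P : Formula 0) → Atomic P → Closed P → TrueClosed P → Rule [] P
    false-rule : ∀ (P : Formula 0) → Atomic P → Closed P → ¬ TrueClosed P →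
                 Rule (P ∷ []) ⊥'

data RuleName : Set where
  hyp  : Label → RuleName
  atom : RuleName
  ∧I ∧E₁ ∧E₂ ∨I₁ ∨I₂ ⇒E : RuleName
  ∨E   : Label → Label → RuleName          -- discharges u (2nd), v (3rd premiss)
  ⇒I   : Label → RuleName
  ∀I   : Name → RuleName                   -- eigenvariable
  ∀E   : Term 0 → RuleName
  ∃I   : Term 0 → RuleName
  ∃E   : Name → Label → RuleName           -- eigenvariable, discharged label
  ind  : Name → Formula 0 → Term 0 → Label → RuleName   -- x, A, main term t, label
  em1  : Formula 1 → Name → Label → Label → RuleName    -- P, y, universal label, existential label

data Tree : Set where
  node : Formula 0 → RuleName → List Tree → Tree

fml : Tree → Formula 0
fml (node F _ _) = F

rl : Tree → RuleName
rl (node _ r _) = r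

-- the terms displayed by a rule instance (the term of ∀E / ∃I and the
-- main term of Ind); they count as occurring in the derivation
ruleTerms : RuleName → List (Term 0)
ruleTerms (∀E t) = t ∷ []
ruleTerms (∃I t) = t ∷ []
ruleTerms (ind _ _ t _) = t ∷ []
ruleTerms _ = []

prems : Tree → List Tree
prems (node _ _ ds) = ds

data IsIntro : RuleName → Set where
  i∧ : IsIntro ∧I
  i∨₁ : IsIntro ∨I₁
  i∨₂ : IsIntro ∨I₂
  i⇒ : ∀ {u} → IsIntro (⇒I u)
  i∀ : ∀ {y} → IsIntro (∀I y)
  i∃ : ∀ {t} → IsIntro (∃I t)

data IsElim : RuleName → Set where
  e∧₁ : IsElim ∧E₁
  e∧₂ : IsElim ∧E₂
  e∨ : ∀ {u v} → IsElim (∨E u v)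
  e⇒ : IsElim ⇒E
  e∀ : ∀ {t} → IsElim (∀E t)
  e∃ : ∀ {y u} → IsElim (∃E y u)

data IsEM1 : RuleName → Set where
  isEM1 : ∀ {P y u v} → IsEM1 (em1 P y u v)

data Discharges : RuleName → ℕ → Label → Set where
  d⇒   : ∀ {u} → Discharges (⇒I u) 0 u
  d∨ˡ  : ∀ {u v} → Discharges (∨E u v) 1 u
  d∨ʳ  : ∀ {u v} → Discharges (∨E u v) 2 v
  d∃   : ∀ {y u} → Discharges (∃E y u) 1 u
  dInd : ∀ {x A t u} → Discharges (ind x A t u) 1 u
  dEMu : ∀ {P y u v} → Discharges (em1 P y u v) 0 u
  dEMv : ∀ {P y u v} → Discharges (em1 P y u v) 1 v

data Binds : RuleName → ℕ → Name → Set where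
  b∀   : ∀ {y} → Binds (∀I y) 0 y
  b∃   : ∀ {y u} → Binds (∃E y u) 1 y
  bInd : ∀ {x A t u} → Binds (ind x A t u) 1 x
  bEM  : ∀ {P y u v} → Binds (em1 P y u v) 1 y

data OpenHyp (u : Label) (F : Formula 0) : Tree → Set where
  here  : OpenHyp u F (node F (hyp u) [])
  there : ∀ {G r ds} (i : Fin (length ds)) → ¬ Discharges r (toℕ i) u →
          OpenHyp u F (llookup ds i) → OpenHyp u F (node G r ds)

Uses : Label → Tree → Set
Uses u d = Σ (Formula 0) λ F → OpenHyp u F d

HypsAre : Label → Formula 0 → Tree → Set
HypsAre u A d = ∀ F → OpenHyp u F d → F ≈ A

FreshExcept : Name → Label → Tree → Set
FreshExcept y u d = ∀ w F → OpenHyp w F d → w ≢ u → ¬ (y ∈fv F)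

FreshHyps : Name → Tree → Set
FreshHyps y d = ∀ w F → OpenHyp w F d → ¬ (y ∈fv F)

module _ (R : AtomicRules) where
  open AtomicRules R

  data WF : Tree → Set where
    hypR  : ∀ {F u} → WF (node F (hyp u) [])
    atomR : ∀ {F ds} → All WF ds →
            (Σ (List (Formula 0)) λ Ps → Σ (Formula 0) λ Q →
               Rule Ps Q × Q ≈ F ×
               Data.List.Relation.Binary.Pointwise.Pointwise _≈_ Ps (lmap fml ds)) →
            WF (node F atom ds)
    ∧IR   : ∀ {F A B d e} → WF d → WF e → fml d ≈ A → fml e ≈ B → F ≈ A ∧' B →
            WF (node F ∧I (d ∷ e ∷ []))
    ∧E₁R  : ∀ {F A B d} → WF d → fml d ≈ A ∧' B → F ≈ A → WF (node F ∧E₁ (d ∷ []))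
    ∧E₂R  : ∀ {F A B d} → WF d → fml d ≈ A ∧' B → F ≈ B → WF (node F ∧E₂ (d ∷ []))
    ∨I₁R  : ∀ {F A B d} → WF d → fml d ≈ A → F ≈ A ∨' B → WF (node F ∨I₁ (d ∷ []))
    ∨I₂R  : ∀ {F A B d} → WF d → fml d ≈ B → F ≈ A ∨' B → WF (node F ∨I₂ (d ∷ []))
    ∨ER   : ∀ {F A B u v d e f} → WF d → WF e → WF f →
            fml d ≈ A ∨' B → fml e ≈ F → fml f ≈ F →
            HypsAre u A e → HypsAre v B f →
            WF (node F (∨E u v) (d ∷ e ∷ f ∷ []))
    ⇒IR   : ∀ {F A B u d} → WF d → fml d ≈ B → F ≈ A ⇒ B → HypsAre u A d →
            WF (node F (⇒I u) (d ∷ []))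
    ⇒ER   : ∀ {F A B d e} → WF d → WF e → fml d ≈ A ⇒ B → fml e ≈ A → F ≈ B →
            WF (node F ⇒E (d ∷ e ∷ []))
    ∀IR   : ∀ {F B y d} → WF d → F ≈ ∀' B → fml d ≈ inst B (fv y) →
            ¬ (y ∈fv F) → FreshHyps y d →
            WF (node F (∀I y) (d ∷ []))
    ∀ER   : ∀ {F B t d} → WF d → fml d ≈ ∀' B → F ≈ inst B t →
            WF (node F (∀E t) (d ∷ []))
    ∃IR   : ∀ {F B t d} → WF d → F ≈ ∃' B → fml d ≈ inst B t →
            WF (node F (∃I t) (d ∷ []))
    ∃ER   : ∀ {F B y u d e} → WF d → WF e → fml d ≈ ∃' B → fml e ≈ F →
            HypsAre u (inst B (fv y)) e →
            ¬ (y ∈fv F) → ¬ (y ∈fv fml d) → FreshExcept y u e →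
            WF (node F (∃E y u) (d ∷ e ∷ []))
    indR  : ∀ {F x A t u d e} → WF d → WF e →
            fml d ≈ substF x 𝟎 A → fml e ≈ substF x (S (fv x)) A →
            HypsAre u A e → FreshExcept x u e → F ≈ substF x t A →
            WF (node F (ind x A t u) (d ∷ e ∷ []))
    em1R  : ∀ {F P y u v d e} → Atomic P → WF d → WF e →
            fml d ≈ F → fml e ≈ F →
            HypsAre u (∀' P) d → HypsAre v (¬' (inst P (fv y))) e →
            ¬ (y ∈fv F) → FreshExcept y v e →
            WF (node F (em1 P y u v) (d ∷ e ∷ []))

-- Branches: a path from the conclusion (root) down to a leaf; read
-- bottom-up it is a_0 (leaf), ..., a_n (root).

data Path : Tree → Set where
  leaf : ∀ {F r} → Path (node F r [])
  step : ∀ {F r ds} (i : Fin (length ds)) → Path (llookup ds i) → Path (node F r ds)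

-- principal: at elimination and EM1 instances the branch passes through
-- the major (leftmost) premiss
data Principal : ∀ {t} → Path t → Set where
  leaf : ∀ {F r} → Principal (leaf {F} {r})
  step : ∀ {F r ds} {i : Fin (length ds)} {p : Path (llookup ds i)} →
         (IsElim r ⊎ IsEM1 r → toℕ i ≡ 0) → Principal p →
         Principal (step {F} {r} {ds} i p)

data AllOn (Q : Formula 0 → Set) : ∀ {t} → Path t → Set where
  leaf : ∀ {F r} → Q F → AllOn Q (leaf {F} {r})
  step : ∀ {F r ds} {i : Fin (length ds)} {p : Path (llookup ds i)} →
         Q F → AllOn Q p → AllOn Q (step {F} {r} {ds} i p)

data NormalOn : ∀ {t} → Path t → Set where
  leaf : ∀ {F r} → NormalF F → All NormalT (ruleTerms r) → NormalOn (leaf {F} {r})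
  step : ∀ {F r ds} {i : Fin (length ds)} {p : Path (llookup ds i)} →
         NormalF F → All NormalT (ruleTerms r) → NormalOn p →
         NormalOn (step {F} {r} {ds} i p)

-- the formula a_1 of a branch (nothing if the branch has length 1)
a₁ : ∀ {t} → Path t → Maybe (Formula 0)
a₁ leaf = nothing
a₁ (step {F} i p) with a₁ p
... | just G = just G
... | nothing = just F

data HypLeaf (u : Label) : ∀ {t} → Path t → Set where
  leaf : ∀ {F} → HypLeaf u (leaf {F} {hyp u})
  step : ∀ {F r ds} {i : Fin (length ds)} {p : Path (llookup ds i)} →
         ¬ Discharges r (toℕ i) u → HypLeaf u p → HypLeaf u (step {F} {r} {ds} i p)

-- side condition of (a) for ∧I: a_{i-2} is the same formula as a_i
data AndOK (F : Formula 0) : ∀ {t} → Path t → Set where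
  notAnd : ∀ {t} {p : Path t} → rl t ≢ ∧I → AndOK F p
  andOK  : ∀ {G es} (j : Fin (length es)) (q : Path (llookup es j)) →
           fml (llookup es j) ≈ F → AndOK F (step {G} {∧I} {es} j q)

data LocalCut : ∀ {t} → Path t → Set where
  cut-a : ∀ {F r ds} {i : Fin (length ds)} {p : Path (llookup ds i)} →
          IsElim r → IsIntro (rl (llookup ds i)) → AndOK F p →
          LocalCut (step {F} {r} {ds} i p)
  cut-b0 : ∀ {F x A u ds} {p : Path (node F (ind x A 𝟎 u) ds)} → LocalCut p
  cut-bS : ∀ {F x A s u ds} {p : Path (node F (ind x A (S s) u) ds)} → LocalCut p
  cut-c1 : ∀ {F P y u v ds} {i : Fin (length ds)} {p : Path (llookup ds i)} →
           toℕ i ≡ 0 → ¬ Uses u (llookup ds i) →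
           LocalCut (step {F} {em1 P y u v} {ds} i p)
  cut-c2 : ∀ {F P y u v ds} {i : Fin (length ds)} {p : Path (llookup ds i)} {G} →
           toℕ i ≡ 0 → HypLeaf u p →
           a₁ (step {F} {em1 P y u v} {ds} i p) ≡ just G → Atomic G → Closed G →
           LocalCut (step {F} {em1 P y u v} {ds} i p)
  cut-d : ∀ {F r ds} {i : Fin (length ds)} {p : Path (llookup ds i)} →
          IsElim r → IsEM1 (rl (llookup ds i)) →
          LocalCut (step {F} {r} {ds} i p)

data HasHeadCut : ∀ {t} → Path t → Set where
  here  : ∀ {t} {p : Path t} → LocalCut p → HasHeadCut p
  there : ∀ {F r ds} {i : Fin (length ds)} {p : Path (llookup ds i)} →
          HasHeadCut p → HasHeadCut (step {F} {r} {ds} i p)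

data FreeIn (x : Name) : Tree → Set where
  here  : ∀ {F r ds} → x ∈fv F → FreeIn x (node F r ds)
  hereT : ∀ {F r ds} → Any (x ∈fvT_) (ruleTerms r) → FreeIn x (node F r ds)
  there : ∀ {F r ds} (i : Fin (length ds)) → ¬ Binds r (toℕ i) x →
          FreeIn x (llookup ds i) → FreeIn x (node F r ds)

data AllAtomic : Tree → Set where
  node : ∀ {F r ds} → Atomic F → All AllAtomic ds → AllAtomic (node F r ds)

-- Induction on the derivation, with the claim strengthened for derivations
-- that may have open assumptions: either there is none and the derivation is
-- atomic or ends in ∃I, or some principal branch ends in an assumption that no
-- rule on it discharges. Below a simple formula only atomic rules, ∃I,
-- eliminations, Ind and EM₁ can occur. Ind is excluded since its closed normal
-- main term is 0 or S s, a head-cut (b). A run of eliminations has a major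
-- premiss that is neither an introduction (a), nor EM₁ (d), nor Ind, so it runs
-- up to an assumption. At EM₁ the principal branch enters the left premiss; if
-- that premiss has no open assumption, or its branch ends in the universal
-- assumption ∀x P, then EM₁ is a head-cut (c): in the second case the
-- eliminations above ∀x P reduce to one ∀E with a closed atomic conclusion.
module Submission where

open import Defs
open import Data.Product using (Σ; _×_; _,_; proj₁; proj₂)
open import Data.Product.Relation.Binary.Pointwise.NonDependent as × using (×-isEquivalence)
open import Data.Sum using (_⊎_; inj₁; inj₂; [_,_])
open import Relation.Nullary using (¬_; yes; no)
open import Relation.Binary.PropositionalEquality using (_≡_; _≢_; refl; sym; trans; cong; subst)
open import Relation.Binary.PropositionalEquality.Properties using (isEquivalence)
open import Function using (_∘_; case_of_)
open import Data.Nat using (ℕ; _≟_)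
open import Data.Fin using (Fin; zero; suc; toℕ)
open import Data.Vec using ([]; _∷_)
open import Data.List using ([]; _∷_; length) renaming (lookup to llookup; map to lmap)
open import Data.List.Relation.Unary.All as All using (All; []; _∷_)
open import Data.List.Relation.Unary.Any as Any using (Any; here; there)
open import Data.List.Relation.Unary.Any.Properties using (lookup-index)
open import Data.List.Membership.Propositional.Properties using (∈-lookup)
open import Data.List.Relation.Binary.Pointwise using (Pointwise; []; _∷_)
open import Data.Maybe using (just)
open import Data.Empty using (⊥; ⊥-elim)
import Relation.Binary.Construct.Closure.Equivalence as EC

≈-sym : ∀ {A B} → A ≈ B → B ≈ A
≈-sym = EC.symmetric _⟶F_

≈-trans : ∀ {A B C} → A ≈ B → B ≈ C → A ≈ C
≈-trans = EC.transitive _⟶F_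

data Shape : Set where
  atomic ∧ₛ ∨ₛ ⇒ₛ : Shape
  ∀ₛ ∃ₛ : Shape → Shape

shape : ∀ {n} → Formula n → Shape
shape (_ ≐ _) = atomic
shape ⊥' = atomic
shape (_ ∧' _) = ∧ₛ
shape (_ ∨' _) = ∨ₛ
shape (_ ⇒ _) = ⇒ₛ
shape (∀' A) = ∀ₛ (shape A)
shape (∃' A) = ∃ₛ (shape A)

∀ₛ-injective : ∀ {s s'} → ∀ₛ s ≡ ∀ₛ s' → s ≡ s'
∀ₛ-injective refl = refl

shape-⟶F : ∀ {n} {A B : Formula n} → A ⟶F B → shape A ≡ shape B
shape-⟶F (≐ˡ _) = refl
shape-⟶F (≐ʳ _) = refl
shape-⟶F (∧ˡ _) = refl
shape-⟶F (∧ʳ _) = refl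
shape-⟶F (∨ˡ _) = refl
shape-⟶F (∨ʳ _) = refl
shape-⟶F (⇒ˡ _) = refl
shape-⟶F (⇒ʳ _) = refl
shape-⟶F (∀b s) = cong ∀ₛ (shape-⟶F s)
shape-⟶F (∃b s) = cong ∃ₛ (shape-⟶F s)

shape-≈ : ∀ {A B} → A ≈ B → shape A ≡ shape B
shape-≈ = EC.gfold isEquivalence shape shape-⟶F

shape-subF : ∀ {m k} (σ : Fin m → Term k) (A : Formula m) → shape (subF σ A) ≡ shape A
shape-subF σ (_ ≐ _) = refl
shape-subF σ ⊥' = refl
shape-subF σ (_ ∧' _) = refl
shape-subF σ (_ ∨' _) = refl
shape-subF σ (_ ⇒ _) = refl
shape-subF σ (∀' A) = cong ∀ₛ (shape-subF (liftS σ) A)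
shape-subF σ (∃' A) = cong ∃ₛ (shape-subF (liftS σ) A)

Atomic⇒shape : ∀ {n} {A : Formula n} → Atomic A → shape A ≡ atomic
Atomic⇒shape (eqA _ _) = refl
Atomic⇒shape botA = refl

shape⇒Atomic : ∀ {n} {A : Formula n} → shape A ≡ atomic → Atomic A
shape⇒Atomic {A = _ ≐ _} _ = eqA _ _
shape⇒Atomic {A = ⊥'} _ = botA

Atomic-resp-≈ : ∀ {A B} → A ≈ B → Atomic A → Atomic B
Atomic-resp-≈ A≈B a = shape⇒Atomic (trans (sym (shape-≈ A≈B)) (Atomic⇒shape a))

-- The junk value (A , A) off conjunctions keeps every reduction step within ≈.
conjuncts : Formula 0 → Formula 0 × Formula 0
conjuncts (A ∧' B) = A , B
conjuncts A = A , A

conjuncts-⟶F : ∀ {A B} → A ⟶F B → ×.Pointwise _≈_ _≈_ (conjuncts A) (conjuncts B)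
conjuncts-⟶F (∧ˡ s) = EC.return s , EC.reflexive _⟶F_
conjuncts-⟶F (∧ʳ s) = EC.reflexive _⟶F_ , EC.return s
conjuncts-⟶F s@(≐ˡ _) = EC.return s , EC.return s
conjuncts-⟶F s@(≐ʳ _) = EC.return s , EC.return s
conjuncts-⟶F s@(∨ˡ _) = EC.return s , EC.return s
conjuncts-⟶F s@(∨ʳ _) = EC.return s , EC.return s
conjuncts-⟶F s@(⇒ˡ _) = EC.return s , EC.return s
conjuncts-⟶F s@(⇒ʳ _) = EC.return s , EC.return s
conjuncts-⟶F s@(∀b _) = EC.return s , EC.return s
conjuncts-⟶F s@(∃b _) = EC.return s , EC.return s

∧-injective-≈ : ∀ {A B A' B'} → A ∧' B ≈ A' ∧' B' → A ≈ A' × B ≈ B'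
∧-injective-≈ = EC.gfold (×-isEquivalence (EC.isEquivalence _⟶F_) (EC.isEquivalence _⟶F_))
                         conjuncts conjuncts-⟶F

-- The equation in ∃atomic lets it be matched against ∃ₛ (shape B).
data SimpleShape : Shape → Set where
  atomic  : SimpleShape atomic
  ∃atomic : ∀ {s} → s ≡ atomic → SimpleShape (∃ₛ s)

SimpleShape-resp-≈ : ∀ {A B} → A ≈ B → SimpleShape (shape A) → SimpleShape (shape B)
SimpleShape-resp-≈ A≈B = subst SimpleShape (shape-≈ A≈B)

Atomic⇒SimpleShape : ∀ {A : Formula 0} → Atomic A → SimpleShape (shape A)
Atomic⇒SimpleShape (eqA _ _) = atomic
Atomic⇒SimpleShape botA = atomic

closed-normal⇒𝟎⊎S : (t : Term 0) → (∀ x → ¬ x ∈fvT t) → NormalT t →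
                     t ≡ 𝟎 ⊎ Σ (Term 0) (λ s → t ≡ S s)
closed-normal⇒𝟎⊎S (fv x) closed _ = ⊥-elim (closed x fvHere)
closed-normal⇒𝟎⊎S (app zeroF []) _ _ = inj₁ refl
closed-normal⇒𝟎⊎S (app succF (s ∷ [])) _ _ = inj₂ (s , refl)
closed-normal⇒𝟎⊎S (app (proj i) ts) _ normal = ⊥-elim (normal _ (β-proj i ts))
closed-normal⇒𝟎⊎S (app (comp g hs) ts) _ normal = ⊥-elim (normal _ (β-comp g hs ts))
closed-normal⇒𝟎⊎S (app (rec g h) (t ∷ ts)) closed normal
  with closed-normal⇒𝟎⊎S t (λ x → closed x ∘ fvApp ∘ fvHd) (λ u → normal _ ∘ ξ-app (rec g h) ∘ hd)
... | inj₁ refl = ⊥-elim (normal _ (β-rec0 g h ts))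
... | inj₂ (s , refl) = ⊥-elim (normal _ (β-recS g h s ts))

leftmost : (d : Tree) → Path d
leftmost (node _ _ []) = leaf
leftmost (node _ _ (d ∷ _)) = step zero (leftmost d)

leftmost-principal : (d : Tree) → Principal (leftmost d)
leftmost-principal (node _ _ []) = leaf
leftmost-principal (node _ _ (d ∷ _)) = step (λ _ → refl) (leftmost-principal d)

leaf-formula : ∀ {d} → Path d → Formula 0
leaf-formula (leaf {F}) = F
leaf-formula (step _ p) = leaf-formula p

HypLeaf⇒OpenHyp : ∀ {w d} {p : Path d} → HypLeaf w p → OpenHyp w (leaf-formula p) d
HypLeaf⇒OpenHyp leaf = here
HypLeaf⇒OpenHyp (step nd h) = there _ nd (HypLeaf⇒OpenHyp h)

NormalOn-root : ∀ {d} {p : Path d} → NormalOn p → All NormalT (ruleTerms (rl d))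
NormalOn-root (leaf _ ts) = ts
NormalOn-root (step _ ts _) = ts

NormalOn-tail : ∀ {F r ds} {i : Fin (length ds)} {p : Path (llookup ds i)} →
                NormalOn (step {F} {r} {ds} i p) → NormalOn p
NormalOn-tail (step _ _ n) = n

PrincipalAt : RuleName → ℕ → Set
PrincipalAt r i = IsElim r ⊎ IsEM1 r → i ≡ 0

elim-major-undischarged : ∀ {r w} → IsElim r → ¬ Discharges r 0 w
elim-major-undischarged () d⇒
elim-major-undischarged () dEMu

elim-major-unbound : ∀ {r x} → IsElim r → ¬ Binds r 0 x
elim-major-unbound () b∀

Normal : Tree → Set
Normal d = ∀ (p : Path d) → Principal p → ¬ HasHeadCut p × NormalOn p

NoFreeVars : Tree → Set
NoFreeVars d = ∀ x → ¬ FreeIn x d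

NoOpenHyps : Tree → Set
NoOpenHyps d = ∀ u F → ¬ OpenHyp u F d

Normal-premiss : ∀ {F r ds} → Normal (node F r ds) →
                 (i : Fin (length ds)) → PrincipalAt r (toℕ i) → Normal (llookup ds i)
Normal-premiss normal i principal p p-principal =
  (λ cut → proj₁ normal-step (there cut)) , NormalOn-tail (proj₂ normal-step)
  where
  normal-step = normal (step i p) (step principal p-principal)

NoFreeVars-premiss : ∀ {F r ds} → NoFreeVars (node F r ds) →
                     (i : Fin (length ds)) → (∀ x → ¬ Binds r (toℕ i) x) → NoFreeVars (llookup ds i)
NoFreeVars-premiss closed i unbound x free = closed x (there i (unbound x) free)

Normal-major : ∀ {F r m ms} → Normal (node F r (m ∷ ms)) → Normal m
Normal-major normal = Normal-premiss normal zero (λ _ → refl)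

NoFreeVars-major : ∀ {F r m ms} → IsElim r → NoFreeVars (node F r (m ∷ ms)) → NoFreeVars m
NoFreeVars-major elim closed = NoFreeVars-premiss closed zero (λ _ → elim-major-unbound elim)

no-cut : ∀ {d} → Normal d → (p : Path d) → Principal p → ¬ LocalCut p
no-cut normal p principal cut = proj₁ (normal p principal) (here cut)

no-leftmost-cut : ∀ {d} → Normal d → ¬ LocalCut (leftmost d)
no-leftmost-cut normal = no-cut normal (leftmost _) (leftmost-principal _)

ind-not-normal : ∀ {F x A t u ds} → Normal (node F (ind x A t u) ds) →
                 NoFreeVars (node F (ind x A t u) ds) → ⊥
ind-not-normal {t = t} normal closed
  with NormalOn-root (proj₂ (normal (leftmost _) (leftmost-principal _)))
... | t-normal ∷ [] with closed-normal⇒𝟎⊎S t (λ x → closed x ∘ hereT ∘ here) t-normal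
...   | inj₁ refl = no-leftmost-cut normal cut-b0
...   | inj₂ (_ , refl) = no-leftmost-cut normal cut-bS

-- Q is what is known when the leaf has the form ∀x P with P atomic, that is,
-- when it may be the universal assumption of an EM₁ instance further down.
record HypBranch (w : Label) (d : Tree) (Q : Path d → Set) : Set where
  constructor hypBranch
  field
    branch    : Path d
    principal : Principal branch
    hyp-leaf  : HypLeaf w branch
    ∀-leaf    : shape (leaf-formula branch) ≡ ∀ₛ atomic → Q branch

step-branch : ∀ {F r ds w} {Q : Path (node F r ds) → Set} (i : Fin (length ds))
              {Q' : Path (llookup ds i) → Set} →
              PrincipalAt r (toℕ i) → ¬ Discharges r (toℕ i) w →
              (∀ q → Q' q → Q (step i q)) →
              HypBranch w (llookup ds i) Q' → HypBranch w (node F r ds) Q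
step-branch i principal undischarged lift (hypBranch q q-principal hyp-leaf ∀-leaf) =
  hypBranch (step i q) (step principal q-principal) (step undischarged hyp-leaf) (lift q ∘ ∀-leaf)

ClosedAtomicA₁ : ∀ {d} → Path d → Set
ClosedAtomicA₁ q = Σ (Formula 0) λ G → a₁ q ≡ just G × Atomic G × Closed G

Exposed : Label → Tree → Set
Exposed w d = HypBranch w d ClosedAtomicA₁

ClosedAtomicA₁-step : ∀ {F r ds} {i : Fin (length ds)} (q : Path (llookup ds i)) →
                      ClosedAtomicA₁ q → ClosedAtomicA₁ (step {F} {r} {ds} i q)
ClosedAtomicA₁-step q (G , eq , atomic-G , closed-G) with a₁ q
ClosedAtomicA₁-step q (G , refl , atomic-G , closed-G) | just _ = G , refl , atomic-G , closed-G

step-exposed : ∀ {F r ds w} (i : Fin (length ds)) →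
               PrincipalAt r (toℕ i) → ¬ Discharges r (toℕ i) w →
               Exposed w (llookup ds i) → Exposed w (node F r ds)
step-exposed {F} {r} {ds} i principal undischarged =
  step-branch i principal undischarged (ClosedAtomicA₁-step {F} {r} {ds} {i})

-- An atomic formula is never a major premiss, so a run of eliminations whose
-- principal branch starts at a universal atomic assumption is a single ∀E.
ElimBranch : Label → Tree → Set
ElimBranch w d = HypBranch w d λ q → Atomic (fml d) × a₁ q ≡ just (fml d)

ElimBranch⇒Exposed : ∀ {w d} → NoFreeVars d → ElimBranch w d → Exposed w d
ElimBranch⇒Exposed {d = node F _ _} closed (hypBranch q q-principal hyp-leaf ∀-leaf) =
  hypBranch q q-principal hyp-leaf λ s →
    let (a , eq) = ∀-leaf s in F , eq , a , λ x → closed x ∘ here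

data Analysis (d : Tree) : Set where
  closed-form : NoOpenHyps d → AllAtomic d ⊎ Σ (Term 0) (λ t → rl d ≡ ∃I t) → Analysis d
  exposed     : ∀ w → Exposed w d → Analysis d

module _ (R : AtomicRules) where
  open AtomicRules R using (atomicPrem; atomicConc)

  elim-major-not-atomic : ∀ {F r m ms} → IsElim r → WF R (node F r (m ∷ ms)) → ¬ Atomic (fml m)
  elim-major-not-atomic e∧₁ (∧E₁R _ m≈ _) a = case Atomic-resp-≈ m≈ a of λ ()
  elim-major-not-atomic e∧₂ (∧E₂R _ m≈ _) a = case Atomic-resp-≈ m≈ a of λ ()
  elim-major-not-atomic e∨ (∨ER _ _ _ m≈ _ _ _ _) a = case Atomic-resp-≈ m≈ a of λ ()
  elim-major-not-atomic e⇒ (⇒ER _ _ m≈ _ _) a = case Atomic-resp-≈ m≈ a of λ ()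
  elim-major-not-atomic e∀ (∀ER _ m≈ _) a = case Atomic-resp-≈ m≈ a of λ ()
  elim-major-not-atomic e∃ (∃ER _ _ m≈ _ _ _ _ _) a = case Atomic-resp-≈ m≈ a of λ ()

  elim-∀atomic-major : ∀ {F r m ms} → IsElim r → WF R (node F r (m ∷ ms)) →
                       shape (fml m) ≡ ∀ₛ atomic → Atomic F
  elim-∀atomic-major e∀ (∀ER {B = B} _ m≈ F≈) s =
    Atomic-resp-≈ (≈-sym F≈)
      (shape⇒Atomic (trans (shape-subF _ B) (∀ₛ-injective (trans (sym (shape-≈ m≈)) s))))
  elim-∀atomic-major e∧₁ (∧E₁R _ m≈ _) s = case trans (sym (shape-≈ m≈)) s of λ ()
  elim-∀atomic-major e∧₂ (∧E₂R _ m≈ _) s = case trans (sym (shape-≈ m≈)) s of λ ()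
  elim-∀atomic-major e∨ (∨ER _ _ _ m≈ _ _ _ _) s = case trans (sym (shape-≈ m≈)) s of λ ()
  elim-∀atomic-major e⇒ (⇒ER _ _ m≈ _ _) s = case trans (sym (shape-≈ m≈)) s of λ ()
  elim-∀atomic-major e∃ (∃ER _ _ m≈ _ _ _ _ _) s = case trans (sym (shape-≈ m≈)) s of λ ()

  elim-∧major : ∀ {F r m ms A B} → IsElim r → WF R (node F r (m ∷ ms)) →
                fml m ≈ A ∧' B → A ≈ F ⊎ B ≈ F
  elim-∧major e∧₁ (∧E₁R _ m≈ F≈) m≈' =
    inj₁ (≈-trans (proj₁ (∧-injective-≈ (≈-trans (≈-sym m≈') m≈))) (≈-sym F≈))
  elim-∧major e∧₂ (∧E₂R _ m≈ F≈) m≈' =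
    inj₂ (≈-trans (proj₂ (∧-injective-≈ (≈-trans (≈-sym m≈') m≈))) (≈-sym F≈))
  elim-∧major e∨ (∨ER _ _ _ m≈ _ _ _ _) m≈' = case shape-≈ (≈-trans (≈-sym m≈') m≈) of λ ()
  elim-∧major e⇒ (⇒ER _ _ m≈ _ _) m≈' = case shape-≈ (≈-trans (≈-sym m≈') m≈) of λ ()
  elim-∧major e∀ (∀ER _ m≈ _) m≈' = case shape-≈ (≈-trans (≈-sym m≈') m≈) of λ ()
  elim-∧major e∃ (∃ER _ _ m≈ _ _ _ _ _) m≈' = case shape-≈ (≈-trans (≈-sym m≈') m≈) of λ ()

  intro-major-cut : ∀ {F r m ms} → IsElim r → IsIntro (rl m) → rl m ≢ ∧I →
                    Normal (node F r (m ∷ ms)) → ⊥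
  intro-major-cut elim intro not-∧ normal = no-leftmost-cut normal (cut-a elim intro (notAnd not-∧))

  through-elim : ∀ {F r m ms} → IsElim r → WF R (node F r (m ∷ ms)) →
                 (Normal m → NoFreeVars m → Σ Label λ w → ElimBranch w m) →
                 Normal (node F r (m ∷ ms)) → NoFreeVars (node F r (m ∷ ms)) →
                 Σ Label λ w → ElimBranch w (node F r (m ∷ ms))
  through-elim elim wf branch-m normal closed
    with branch-m (Normal-major normal) (NoFreeVars-major elim closed)
  ... | w , b = w , step-branch zero (λ _ → refl) (elim-major-undischarged elim)
                      (λ _ (a , _) → ⊥-elim (elim-major-not-atomic elim wf a)) b

  mutual
    elim-branch : ∀ {F r m ms} → IsElim r → WF R (node F r (m ∷ ms)) →
                  Normal (node F r (m ∷ ms)) → NoFreeVars (node F r (m ∷ ms)) →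
                  Σ Label λ w → ElimBranch w (node F r (m ∷ ms))
    elim-branch e∧₁ wf@(∧E₁R wm _ _) = major-branch e∧₁ wf wm
    elim-branch e∧₂ wf@(∧E₂R wm _ _) = major-branch e∧₂ wf wm
    elim-branch e∨ wf@(∨ER wm _ _ _ _ _ _ _) = major-branch e∨ wf wm
    elim-branch e⇒ wf@(⇒ER wm _ _ _ _) = major-branch e⇒ wf wm
    elim-branch e∀ wf@(∀ER wm _ _) = major-branch e∀ wf wm
    elim-branch e∃ wf@(∃ER wm _ _ _ _ _ _ _) = major-branch e∃ wf wm

    major-branch : ∀ {F r m ms} → IsElim r → WF R (node F r (m ∷ ms)) → WF R m →
                   Normal (node F r (m ∷ ms)) → NoFreeVars (node F r (m ∷ ms)) →
                   Σ Label λ w → ElimBranch w (node F r (m ∷ ms))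
    major-branch elim wf (hypR {u = u}) _ _ =
      u , hypBranch (step zero leaf) (step (λ _ → refl) leaf) (step (elim-major-undischarged elim) leaf)
                    λ s → elim-∀atomic-major elim wf s , refl
    major-branch elim wf (atomR _ (_ , _ , rule , Q≈ , _)) _ _ =
      ⊥-elim (elim-major-not-atomic elim wf (Atomic-resp-≈ Q≈ (atomicConc rule)))
    major-branch elim wf wm@(∧E₁R _ _ _) = through-elim elim wf (elim-branch e∧₁ wm)
    major-branch elim wf wm@(∧E₂R _ _ _) = through-elim elim wf (elim-branch e∧₂ wm)
    major-branch elim wf wm@(∨ER _ _ _ _ _ _ _ _) = through-elim elim wf (elim-branch e∨ wm)
    major-branch elim wf wm@(⇒ER _ _ _ _ _) = through-elim elim wf (elim-branch e⇒ wm)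
    major-branch elim wf wm@(∀ER _ _ _) = through-elim elim wf (elim-branch e∀ wm)
    major-branch elim wf wm@(∃ER _ _ _ _ _ _ _ _) = through-elim elim wf (elim-branch e∃ wm)
    major-branch {F} elim wf (∧IR {d = d₀} {e = d₁} _ _ d₀≈ d₁≈ m≈) normal _ =
      ⊥-elim ([ ∧I-cut zero ∘ ≈-trans d₀≈ , ∧I-cut (suc zero) ∘ ≈-trans d₁≈ ] (elim-∧major elim wf m≈))
      where
      ∧I-cut : (j : Fin 2) → fml (llookup (d₀ ∷ d₁ ∷ []) j) ≈ F → ⊥
      ∧I-cut j j≈ = no-cut normal (step zero (step j (leftmost _)))
                      (step (λ _ → refl) (step (λ { (inj₁ ()) ; (inj₂ ()) }) (leftmost-principal _)))
                      (cut-a elim i∧ (andOK j (leftmost _) j≈))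
    major-branch elim _ (∨I₁R _ _ _) normal _ = ⊥-elim (intro-major-cut elim i∨₁ (λ ()) normal)
    major-branch elim _ (∨I₂R _ _ _) normal _ = ⊥-elim (intro-major-cut elim i∨₂ (λ ()) normal)
    major-branch elim _ (⇒IR _ _ _ _) normal _ = ⊥-elim (intro-major-cut elim i⇒ (λ ()) normal)
    major-branch elim _ (∀IR _ _ _ _ _) normal _ = ⊥-elim (intro-major-cut elim i∀ (λ ()) normal)
    major-branch elim _ (∃IR _ _ _) normal _ = ⊥-elim (intro-major-cut elim i∃ (λ ()) normal)
    major-branch elim _ (indR _ _ _ _ _ _ _) normal closed =
      ⊥-elim (ind-not-normal (Normal-major normal) (NoFreeVars-major elim closed))
    major-branch elim _ (em1R _ _ _ _ _ _ _ _ _) normal _ =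
      ⊥-elim (no-leftmost-cut normal (cut-d elim isEM1))

  ∃I-not-atomic : ∀ {d t} → rl d ≡ ∃I t → WF R d → ¬ Atomic (fml d)
  ∃I-not-atomic {node _ _ _} refl (∃IR _ F≈ _) a = case Atomic-resp-≈ F≈ a of λ ()

  elim-exposed : ∀ {F r m ms} → IsElim r → WF R (node F r (m ∷ ms)) →
                 Normal (node F r (m ∷ ms)) → NoFreeVars (node F r (m ∷ ms)) →
                 Analysis (node F r (m ∷ ms))
  elim-exposed elim wf normal closed =
    let w , b = elim-branch elim wf normal closed in exposed w (ElimBranch⇒Exposed closed b)

  mutual
    analyse : ∀ {d} → WF R d → SimpleShape (shape (fml d)) → Normal d → NoFreeVars d → Analysis d
    analyse (hypR {u = u}) simple _ _ =
      exposed u (hypBranch leaf leaf leaf λ s → case subst SimpleShape s simple of λ ())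
    analyse (atomR {F} {ds} wfs (_ , _ , rule , Q≈ , Ps≈)) _ normal closed
      with atomic-premisses wfs Ps≈ (atomicPrem rule)
             (λ i → Normal-premiss normal i λ { (inj₁ ()) ; (inj₂ ()) })
             (λ i → NoFreeVars-premiss closed i λ _ ())
    ... | inj₁ atomic-closed =
      closed-form (λ { w G (there i _ open-G) →
                         proj₁ (All.lookup atomic-closed (∈-lookup i)) w G open-G })
                  (inj₁ (node (Atomic-resp-≈ Q≈ (atomicConc rule)) (All.map proj₂ atomic-closed)))
    ... | inj₂ some-exposed =
      let (w , b) = lookup-index some-exposed
      in exposed w (step-exposed (Any.index some-exposed) (λ { (inj₁ ()) ; (inj₂ ()) }) (λ ()) b)
    analyse (∧IR _ _ _ _ F≈) simple _ _ = case SimpleShape-resp-≈ F≈ simple of λ ()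
    analyse (∨I₁R _ _ F≈) simple _ _ = case SimpleShape-resp-≈ F≈ simple of λ ()
    analyse (∨I₂R _ _ F≈) simple _ _ = case SimpleShape-resp-≈ F≈ simple of λ ()
    analyse (⇒IR _ _ F≈ _) simple _ _ = case SimpleShape-resp-≈ F≈ simple of λ ()
    analyse (∀IR _ F≈ _ _ _) simple _ _ = case SimpleShape-resp-≈ F≈ simple of λ ()
    analyse (∃IR {B = B} {t} wd F≈ d≈) simple normal closed with SimpleShape-resp-≈ F≈ simple
    ... | ∃atomic B-atomic
      with analyse wd
             (Atomic⇒SimpleShape (Atomic-resp-≈ (≈-sym d≈) (shape⇒Atomic (trans (shape-subF _ B) B-atomic))))
             (Normal-major normal) (NoFreeVars-premiss closed zero λ _ ())
    ...   | closed-form no-open _ =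
      closed-form (λ { w G (there zero _ open-G) → no-open w G open-G }) (inj₂ (t , refl))
    ...   | exposed w b = exposed w (step-exposed zero (λ { (inj₁ ()) ; (inj₂ ()) }) (λ ()) b)
    analyse wd@(∧E₁R _ _ _) _ normal closed = elim-exposed e∧₁ wd normal closed
    analyse wd@(∧E₂R _ _ _) _ normal closed = elim-exposed e∧₂ wd normal closed
    analyse wd@(∨ER _ _ _ _ _ _ _ _) _ normal closed = elim-exposed e∨ wd normal closed
    analyse wd@(⇒ER _ _ _ _ _) _ normal closed = elim-exposed e⇒ wd normal closed
    analyse wd@(∀ER _ _ _) _ normal closed = elim-exposed e∀ wd normal closed
    analyse wd@(∃ER _ _ _ _ _ _ _ _) _ normal closed = elim-exposed e∃ wd normal closed
    analyse (indR _ _ _ _ _ _ _) _ normal closed = ⊥-elim (ind-not-normal normal closed)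
    analyse (em1R {F} {P} {y} {u} {v} {d} {e} P-atomic wd _ d≈ _ u-hyps _ _ _) simple normal closed
      with analyse wd (SimpleShape-resp-≈ (≈-sym d≈) simple)
             (Normal-major normal) (NoFreeVars-premiss closed zero λ _ ())
    ... | closed-form no-open _ =
      ⊥-elim (no-leftmost-cut normal (cut-c1 refl λ (G , open-G) → no-open u G open-G))
    ... | exposed w b@(hypBranch q q-principal hyp-leaf ∀-leaf) with w ≟ u
    ...   | no w≢u = exposed w (step-exposed zero (λ _ → refl) (λ { dEMu → w≢u refl }) b)
    ...   | yes refl =
      let universal-leaf =
            trans (shape-≈ (u-hyps _ (HypLeaf⇒OpenHyp hyp-leaf))) (cong ∀ₛ (Atomic⇒shape P-atomic))
          G , a₁≡G , G-atomic , G-closed =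
            ClosedAtomicA₁-step {F} {em1 P y u v} {d ∷ e ∷ []} {zero} q (∀-leaf universal-leaf)
      in ⊥-elim (no-cut normal (step zero q) (step (λ _ → refl) q-principal)
                   (cut-c2 refl hyp-leaf a₁≡G G-atomic G-closed))

    atomic-premisses : ∀ {Ps ds} → All (WF R) ds → Pointwise _≈_ Ps (lmap fml ds) → All Atomic Ps →
                       (∀ i → Normal (llookup ds i)) → (∀ i → NoFreeVars (llookup ds i)) →
                       All (λ d → NoOpenHyps d × AllAtomic d) ds ⊎
                       Any (λ d → Σ Label λ w → Exposed w d) ds
    atomic-premisses [] [] [] _ _ = inj₁ []
    atomic-premisses (wd ∷ wds) (P≈ ∷ Ps≈) (P-atomic ∷ Ps-atomic) normal closed
      with analyse wd (Atomic⇒SimpleShape (Atomic-resp-≈ P≈ P-atomic)) (normal zero) (closed zero)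
    ... | exposed w b = inj₂ (here (w , b))
    ... | closed-form _ (inj₂ (_ , ∃I-root)) =
      ⊥-elim (∃I-not-atomic ∃I-root wd (Atomic-resp-≈ P≈ P-atomic))
    ... | closed-form no-open (inj₁ all-atomic)
      with atomic-premisses wds Ps≈ Ps-atomic (normal ∘ suc) (closed ∘ suc)
    ...   | inj₁ rest = inj₁ ((no-open , all-atomic) ∷ rest)
    ...   | inj₂ later = inj₂ (there later)

Simple⇒SimpleShape : ∀ {A} → Atomic A ⊎ SimplyExistential A → SimpleShape (shape A)
Simple⇒SimpleShape (inj₁ A-atomic) = Atomic⇒SimpleShape A-atomic
Simple⇒SimpleShape (inj₂ (_ , P-atomic , refl)) = ∃atomic (Atomic⇒shape P-atomic)

AllAtomic-root : ∀ {d} → AllAtomic d → Atomic (fml d)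
AllAtomic-root (node a _) = a

theorem1 : (R : AtomicRules) (A : Formula 0) (Π : Tree) →
    WF R Π → fml Π ≡ A → Simple A →
    (∀ (p : Path Π) → Principal p → ¬ HasHeadCut p × NormalOn p) →
    (∀ x → ¬ FreeIn x Π) →
    (∀ u F → ¬ OpenHyp u F Π) →
    (AllAtomic Π ⊎ Σ (Term 0) (λ t → rl Π ≡ ∃I t))
    × (SimplyExistential A → IsIntro (rl Π))
theorem1 R _ Π wf refl (_ , simple) normal closed no-open = atomic-or-∃I , existential⇒intro
  where
  atomic-or-∃I : AllAtomic Π ⊎ Σ (Term 0) (λ t → rl Π ≡ ∃I t)
  atomic-or-∃I with analyse R wf (Simple⇒SimpleShape simple) normal closed
  ... | closed-form _ form = form
  ... | exposed w b = ⊥-elim (no-open w _ (HypLeaf⇒OpenHyp (HypBranch.hyp-leaf b)))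

  existential⇒intro : SimplyExistential (fml Π) → IsIntro (rl Π)
  existential⇒intro (_ , _ , Π≡∃P) with atomic-or-∃I
  ... | inj₁ all-atomic = case subst Atomic Π≡∃P (AllAtomic-root all-atomic) of λ ()
  ... | inj₂ (_ , ∃I-root) = subst IsIntro (sym ∃I-root) i∃
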